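{- Let $G$ be a finite, simple, connected graph which is randomly $k$-dimensional, and let $u,v$ be two non-adjacent vertices of $G$. Then $\deg(u)+\deg(v)\geq k$.
   Context: $d(x,y)$ is the distance in $G$. For an ordered set $W=\{w_1,\ldots,w_k\}\subseteq V(G)$ and $v\in V(G)$, $r(v|W)=(d(v,w_1),\ldots,d(v,w_k))$. $W$ is a resolving set if distinct vertices have distinct representations with respect to $W$. The metric dimension $\beta(G)$ is the minimum size of a resolving set; a resolving set of size $\beta(G)$ is a basis. $G$ is randomly $k$-dimensional if $\beta(G)=k$ and every $k$-subset of $V(G)$ is a basis of $G$. -}

module Defs where

open import Data.Nat using (ℕ; zero; suc; _<_; _≤_)
open import Data.Bool using (Bool; true; false; T)
open import Data.Fin using (Fin)
open import Data.Fin.Subset using (Subset; _∈_; ∣_∣)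
open import Data.List using (List; length; filter)
open import Data.List.Base using (allFin)
open import Data.Product using (Σ; ∃; _×_)
open import Relation.Binary.PropositionalEquality using (_≡_)
open import Relation.Nullary using (¬_)
open import Data.Bool.Properties using (T?)

record Graph (n : ℕ) : Set where
  field
    adj   : Fin n → Fin n → Bool
    sym   : ∀ x y → adj x y ≡ adj y x
    irrefl : ∀ x → adj x x ≡ false

module _ {n : ℕ} (G : Graph n) where
  open Graph G

  Adj : Fin n → Fin n → Set
  Adj x y = T (adj x y)

  data Walk : Fin n → Fin n → ℕ → Set where
    here : ∀ {x} → Walk x x zero
    step : ∀ {x y z m} → Adj x y → Walk y z m → Walk x z (suc m)

  Connected : Set
  Connected = ∀ x y → ∃ λ m → Walk x y m

  Dist : Fin n → Fin n → ℕ → Set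
  Dist x y m = Walk x y m × (∀ m′ → m′ < m → ¬ Walk x y m′)

  deg : Fin n → ℕ
  deg x = length (filter (λ y → T? (adj x y)) (allFin n))

  Resolving : Subset n → Set
  Resolving W = ∀ x y →
    (∀ w → w ∈ W → ∀ m → Dist x w m → Dist y w m) → x ≡ y

  MetricDim : ℕ → Set
  MetricDim k = (Σ (Subset n) λ W → Resolving W × ∣ W ∣ ≡ k)
              × (∀ W → Resolving W → k ≤ ∣ W ∣)

  RandomlyDim : ℕ → Set
  RandomlyDim k = MetricDim k × (∀ W → ∣ W ∣ ≡ k → Resolving W)

-- Suppose deg u + deg v < k for non-adjacent u ≠ v. A set W of k − 1 vertices does not
-- resolve G, but W ∪ {s} does for every s ∉ W, so two vertices x ≠ y with equal
-- distances to W are separated by every s ∉ W. A vertex s ∉ W with all its neighbours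
-- in W sees x and y at equal distance (distances from s are one more than the least
-- distance from a neighbour), so it must be x or y.
-- If V ∖ {u, v} has more than k − 1 elements, extend N(u) ∪ N(v) inside V ∖ {u, v} to
-- such a W leaving out a third vertex a. Then {x, y} = {u, v}, so u and v have the
-- same neighbours, hence the same distance to a: a contradiction. Otherwise
-- |V ∖ {u, v}| = k − 1, and for a neighbour z of u the set V ∖ {v, z}, also of size
-- k − 1, is resolving because u separates v from z.

module Submission where

open import Defs
open import Data.Nat using (ℕ; zero; suc; _+_; _≤_; _<_; _≥_; z≤n; s≤s; _≤?_)
open import Data.Nat.Properties
  using ( ≤-trans; ≤-antisym; ≤-pred; +-suc; +-monoʳ-≤; n≤1+n; <⇒≤; <⇒≱; ≰⇒>; ≮⇒≥; 1+n≰n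
        ; n≤0⇒n≡0; n≢0⇒n>0; m≤n⇒m<n∨m≡n; suc-injective; anyUpTo?; module ≤-Reasoning)
open import Data.Bool using (Bool; true; false; T)
open import Data.Bool.Properties using (T?; T-≡)
open import Data.Fin using (Fin; zero; suc; _≟_)
open import Data.Fin.Properties using (any?)
open import Data.Fin.Subset
open import Data.Fin.Subset.Properties
open import Data.Vec using (_∷_; []; here; there; tabulate)
open import Data.Vec.Properties using (lookup∘tabulate; []=⇒lookup; lookup⇒[]=)
import Data.List as List
open import Data.Nat.Induction using (<-rec)
open import Function.Bundles using (Equivalence)
open import Data.Product using (∃; _×_; _,_; proj₁; proj₂)
open import Data.Sum using (_⊎_; inj₁; inj₂; [_,_])
open import Relation.Binary.PropositionalEquality
  using (_≡_; _≢_; refl; sym; trans; cong; subst; subst₂; module ≡-Reasoning)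
open import Relation.Nullary using (¬_; Dec; yes; no)
open import Relation.Unary using (Decidable)
open import Relation.Nullary.Decidable using (_×-dec_; ¬?; decidable-stable)
open import Relation.Nullary.Negation using (contradiction)
open import Function using (_∘_; flip)

private variable
  n : ℕ

∣p∪q∣≤∣p∣+∣q∣ : ∀ (p q : Subset n) → ∣ p ∪ q ∣ ≤ ∣ p ∣ + ∣ q ∣
∣p∪q∣≤∣p∣+∣q∣ []            []            = z≤n
∣p∪q∣≤∣p∣+∣q∣ (inside ∷ p)  (inside ∷ q)  =
  s≤s (≤-trans (∣p∪q∣≤∣p∣+∣q∣ p q) (+-monoʳ-≤ ∣ p ∣ (n≤1+n ∣ q ∣)))
∣p∪q∣≤∣p∣+∣q∣ (inside ∷ p)  (outside ∷ q) = s≤s (∣p∪q∣≤∣p∣+∣q∣ p q)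
∣p∪q∣≤∣p∣+∣q∣ (outside ∷ p) (inside ∷ q)  =
  subst (suc ∣ p ∪ q ∣ ≤_) (sym (+-suc ∣ p ∣ ∣ q ∣)) (s≤s (∣p∪q∣≤∣p∣+∣q∣ p q))
∣p∪q∣≤∣p∣+∣q∣ (outside ∷ p) (outside ∷ q) = ∣p∪q∣≤∣p∣+∣q∣ p q

x∈p─q⇒x∉q : ∀ {x} (p q : Subset n) → x ∈ p ─ q → x ∉ q
x∈p─q⇒x∉q (_ ∷ p) (outside ∷ q) here           ()
x∈p─q⇒x∉q (_ ∷ p) (_       ∷ q) (there x∈p─q) (there x∈q) = x∈p─q⇒x∉q p q x∈p─q x∈q

x∈p-y⇒x≢y : ∀ {x y} {p : Subset n} → x ∈ p - y → x ≢ y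
x∈p-y⇒x≢y {y = y} {p} x∈p-y refl = x∈p─q⇒x∉q p ⁅ y ⁆ x∈p-y (x∈⁅x⁆ y)

x∉p⇒∣p∪⁅x⁆∣≡1+∣p∣ : ∀ {x} {p : Subset n} → x ∉ p → ∣ p ∪ ⁅ x ⁆ ∣ ≡ suc ∣ p ∣
x∉p⇒∣p∪⁅x⁆∣≡1+∣p∣ {x = zero}  {outside ∷ p} _ = cong suc (cong ∣_∣ (∪-identityʳ p))
x∉p⇒∣p∪⁅x⁆∣≡1+∣p∣ {x = zero}  {inside ∷ p}  x∉p = contradiction here x∉p
x∉p⇒∣p∪⁅x⁆∣≡1+∣p∣ {x = suc x} {outside ∷ p} x∉p = x∉p⇒∣p∪⁅x⁆∣≡1+∣p∣ (x∉p ∘ there)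
x∉p⇒∣p∪⁅x⁆∣≡1+∣p∣ {x = suc x} {inside ∷ p}  x∉p = cong suc (x∉p⇒∣p∪⁅x⁆∣≡1+∣p∣ (x∉p ∘ there))

x∈p⇒∣p∣≡1+∣p-x∣ : ∀ {x} {p : Subset n} → x ∈ p → ∣ p ∣ ≡ suc ∣ p - x ∣
x∈p⇒∣p∣≡1+∣p-x∣ {p = inside ∷ p}  here       = cong (suc ∘ ∣_∣) (sym (p─⊥≡p p))
x∈p⇒∣p∣≡1+∣p-x∣ {p = inside ∷ p}  (there x∈p) = cong suc (x∈p⇒∣p∣≡1+∣p-x∣ x∈p)
x∈p⇒∣p∣≡1+∣p-x∣ {p = outside ∷ p} (there x∈p) = x∈p⇒∣p∣≡1+∣p-x∣ x∈p

x,y∈p⇒∣p-x∣≡∣p-y∣ : ∀ {x y} {p : Subset n} → x ∈ p → y ∈ p → ∣ p - x ∣ ≡ ∣ p - y ∣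
x,y∈p⇒∣p-x∣≡∣p-y∣ x∈p y∈p =
  suc-injective (trans (sym (x∈p⇒∣p∣≡1+∣p-x∣ x∈p)) (x∈p⇒∣p∣≡1+∣p-x∣ y∈p))

∣p∣<∣q∣⇒∃[x∈q∖p] : ∀ {p q : Subset n} → ∣ p ∣ < ∣ q ∣ → ∃ λ x → x ∈ q × x ∉ p
∣p∣<∣q∣⇒∃[x∈q∖p] {p = p} {q} ∣p∣<∣q∣ with any? (λ x → x ∈? q ×-dec ¬? (x ∈? p))
... | yes x∈q∖p = x∈q∖p
... | no ∄x∈q∖p = contradiction (p⊆q⇒∣p∣≤∣q∣ q⊆p) (<⇒≱ ∣p∣<∣q∣)
  where
  q⊆p : q ⊆ p
  q⊆p {x} x∈q = decidable-stable (x ∈? p) (λ x∉p → ∄x∈q∖p (x , x∈q , x∉p))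

⊆-interpolate : ∀ {p q : Subset n} j → p ⊆ q → ∣ p ∣ ≤ j → j ≤ ∣ q ∣ →
                ∃ λ r → p ⊆ r × r ⊆ q × ∣ r ∣ ≡ j
⊆-interpolate {p = []} {[]} j _ _ j≤0 = [] , (λ ()) , (λ ()) , sym (n≤0⇒n≡0 j≤0)
⊆-interpolate {p = inside ∷ p} {outside ∷ q} j p⊆q _ _ = contradiction (p⊆q here) λ ()
⊆-interpolate {p = outside ∷ p} {outside ∷ q} j p⊆q ∣p∣≤j j≤∣q∣
  with r , p⊆r , r⊆q , ∣r∣≡j ← ⊆-interpolate j (drop-∷-⊆ p⊆q) ∣p∣≤j j≤∣q∣
  = outside ∷ r , s⊆s p⊆r , s⊆s r⊆q , ∣r∣≡j
⊆-interpolate {p = inside ∷ p} {inside ∷ q} (suc j) p⊆q (s≤s ∣p∣≤j) (s≤s j≤∣q∣)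
  with r , p⊆r , r⊆q , ∣r∣≡j ← ⊆-interpolate j (drop-∷-⊆ p⊆q) ∣p∣≤j j≤∣q∣
  = inside ∷ r , s⊆s p⊆r , s⊆s r⊆q , cong suc ∣r∣≡j
⊆-interpolate {p = outside ∷ p} {inside ∷ q} j p⊆q ∣p∣≤j j≤1+∣q∣ with j ≤? ∣ q ∣
... | yes j≤∣q∣
  with r , p⊆r , r⊆q , ∣r∣≡j ← ⊆-interpolate j (drop-∷-⊆ p⊆q) ∣p∣≤j j≤∣q∣
  = outside ∷ r , s⊆s p⊆r , out⊆ r⊆q , ∣r∣≡j
⊆-interpolate {p = outside ∷ p} {inside ∷ q} zero _ _ _ | no 0≰∣q∣ = contradiction z≤n 0≰∣q∣
⊆-interpolate {p = outside ∷ p} {inside ∷ q} (suc j) p⊆q _ (s≤s j≤∣q∣) | no j≰∣q∣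
  with r , p⊆r , r⊆q , ∣r∣≡j ← ⊆-interpolate j (drop-∷-⊆ p⊆q)
         (≤-trans (p⊆q⇒∣p∣≤∣q∣ (drop-∷-⊆ p⊆q)) (≤-pred (≰⇒> j≰∣q∣))) j≤∣q∣
  = inside ∷ r , out⊆ p⊆r , s⊆s r⊆q , cong suc ∣r∣≡j

module _ {a} {A : Set a} (f : A → Bool) where

  length-filter-tabulate : ∀ {m} (g : Fin m → A) →
    List.length (List.filter (T? ∘ f) (List.tabulate g)) ≡ ∣ tabulate (f ∘ g) ∣
  length-filter-tabulate {zero}  g = refl
  length-filter-tabulate {suc m} g with f (g zero)
  ... | true  = cong suc (length-filter-tabulate (g ∘ suc))
  ... | false = length-filter-tabulate (g ∘ suc)

IsLeast : ∀ {p} → (ℕ → Set p) → ℕ → Set p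
IsLeast P m = P m × (∀ m′ → m′ < m → ¬ P m′)

module _ {p} {P : ℕ → Set p} where

  IsLeast-unique : ∀ {m m′} → IsLeast P m → IsLeast P m′ → m ≡ m′
  IsLeast-unique (Pm , below-m) (Pm′ , below-m′) =
    ≤-antisym (≮⇒≥ λ m′<m → below-m _ m′<m Pm′) (≮⇒≥ λ m<m′ → below-m′ _ m<m′ Pm)

  least-witness : Decidable P → ∀ {m} → P m → ∃ (IsLeast P)
  least-witness P? {m} = <-rec (λ m → P m → ∃ (IsLeast P)) go m
    where
    go : ∀ m → (∀ {m′} → m′ < m → P m′ → ∃ (IsLeast P)) → P m → ∃ (IsLeast P)
    go m smaller Pm with anyUpTo? P? m
    ... | yes (m′ , m′<m , Pm′) = smaller m′<m Pm′
    ... | no none = m , Pm , λ m′ m′<m Pm′ → none (m′ , m′<m , Pm′)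

module Neighbourhoods {n} (G : Graph n) where
  open Graph G using (adj; irrefl)

  Nbhd : Fin n → Subset n
  Nbhd x = tabulate (adj x)

  Adj⇒∈Nbhd : ∀ {x y} → Adj G x y → y ∈ Nbhd x
  Adj⇒∈Nbhd {x} {y} x~y =
    lookup⇒[]= y (Nbhd x) (trans (lookup∘tabulate (adj x) y) (Equivalence.to T-≡ x~y))

  ∈Nbhd⇒Adj : ∀ {x y} → y ∈ Nbhd x → Adj G x y
  ∈Nbhd⇒Adj {x} {y} y∈Nx =
    Equivalence.from T-≡ (trans (sym (lookup∘tabulate (adj x) y)) ([]=⇒lookup y∈Nx))

  deg≡∣Nbhd∣ : ∀ x → deg G x ≡ ∣ Nbhd x ∣
  deg≡∣Nbhd∣ x = length-filter-tabulate (adj x) (λ y → y)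

  Adj⇒≢ : ∀ {x y} → Adj G x y → x ≢ y
  Adj⇒≢ {x} x~x refl = subst T (irrefl x) x~x

  Adj-sym : ∀ {x y} → Adj G x y → Adj G y x
  Adj-sym {x} {y} = subst T (Graph.sym G x y)

module Distances {n} (G : Graph n) (connected : Connected G) where
  open Graph G using (adj)
  open Neighbourhoods G

  walk? : ∀ m x y → Dec (Walk G x y m)
  walk? zero x y with x ≟ y
  ... | yes refl = yes here
  ... | no x≢y   = no λ { here → x≢y refl }
  walk? (suc m) x y with any? (λ w → T? (adj x w) ×-dec walk? m w y)
  ... | yes (w , x~w , walk) = yes (step x~w walk)
  ... | no ∄w                = no λ { (step x~w walk) → ∄w (_ , x~w , walk) }

  dist : Fin n → Fin n → ℕ
  dist x y = proj₁ (least-witness (λ m → walk? m x y) (proj₂ (connected x y)))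

  Dist-dist : ∀ x y → Dist G x y (dist x y)
  Dist-dist x y = proj₂ (least-witness (λ m → walk? m x y) (proj₂ (connected x y)))

  Dist⇒≡dist : ∀ {x y m} → Dist G x y m → m ≡ dist x y
  Dist⇒≡dist {x} {y} D = IsLeast-unique D (Dist-dist x y)

  dist-walk : ∀ x y → Walk G x y (dist x y)
  dist-walk x y = proj₁ (Dist-dist x y)

  dist-minimal : ∀ {x y m} → Walk G x y m → dist x y ≤ m
  dist-minimal {x} {y} walk = ≮⇒≥ λ m<d → proj₂ (Dist-dist x y) _ m<d walk

  walk-snoc : ∀ {x y z m} → Walk G x y m → Adj G y z → Walk G x z (suc m)
  walk-snoc here            y~z = step y~z here
  walk-snoc (step x~w walk) y~z = step x~w (walk-snoc walk y~z)

  walk-reverse : ∀ {x y m} → Walk G x y m → Walk G y x m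
  walk-reverse here            = here
  walk-reverse (step x~w walk) = walk-snoc (walk-reverse walk) (Adj-sym x~w)

  dist-sym : ∀ x y → dist x y ≡ dist y x
  dist-sym x y = ≤-antisym (dist-minimal (walk-reverse (dist-walk y x)))
                           (dist-minimal (walk-reverse (dist-walk x y)))

  dist-refl : ∀ x → dist x x ≡ 0
  dist-refl x = n≤0⇒n≡0 (dist-minimal here)

  dist≡0⇒≡ : ∀ {x y} → dist x y ≡ 0 → x ≡ y
  dist≡0⇒≡ {x} {y} d≡0 = walk₀⇒≡ (subst (Walk G x y) d≡0 (dist-walk x y))
    where
    walk₀⇒≡ : ∀ {x y} → Walk G x y 0 → x ≡ y
    walk₀⇒≡ here = refl

  dist≡1⇒Adj : ∀ {x y} → dist x y ≡ 1 → Adj G x y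
  dist≡1⇒Adj {x} {y} d≡1 = walk₁⇒Adj (subst (Walk G x y) d≡1 (dist-walk x y))
    where
    walk₁⇒Adj : ∀ {x y} → Walk G x y 1 → Adj G x y
    walk₁⇒Adj (step x~y here) = x~y

  Adj⇒dist≡1 : ∀ {x y} → Adj G x y → dist x y ≡ 1
  Adj⇒dist≡1 x~y = ≤-antisym (dist-minimal (step x~y here))
                             (n≢0⇒n>0 (Adj⇒≢ x~y ∘ dist≡0⇒≡))

  dist-≤-via-neighbour : ∀ {x w} y → Adj G x w → dist x y ≤ suc (dist w y)
  dist-≤-via-neighbour {w = w} y x~w = dist-minimal (step x~w (dist-walk w y))

  ∃-closer-neighbour : ∀ {x y} → x ≢ y → ∃ λ w → Adj G x w × suc (dist w y) ≤ dist x y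
  ∃-closer-neighbour {x} {y} x≢y = first-step (dist-walk x y)
    where
    first-step : ∀ {m} → Walk G x y m → ∃ λ w → Adj G x w × suc (dist w y) ≤ m
    first-step here            = contradiction refl x≢y
    first-step (step x~w walk) = _ , x~w , s≤s (dist-minimal walk)

  neighbours-agree⇒dist≡ : ∀ {s x y} → s ≢ x → s ≢ y →
    (∀ w → Adj G s w → dist w x ≡ dist w y) → dist s x ≡ dist s y
  neighbours-agree⇒dist≡ {s} s≢x s≢y agree =
    ≤-antisym (dist-≤ s≢y agree) (dist-≤ s≢x (λ w s~w → sym (agree w s~w)))
    where
    dist-≤ : ∀ {x y} → s ≢ y → (∀ w → Adj G s w → dist w x ≡ dist w y) → dist s x ≤ dist s y
    dist-≤ {x} {y} s≢y agree with w , s~w , closer ← ∃-closer-neighbour s≢y = begin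
      dist s x        ≤⟨ dist-≤-via-neighbour x s~w ⟩
      suc (dist w x)  ≡⟨ cong suc (agree w s~w) ⟩
      suc (dist w y)  ≤⟨ closer ⟩
      dist s y        ∎
      where open ≤-Reasoning

  Nbhd⊆⇒dist-≤ : ∀ {u v a} → Nbhd u ⊆ Nbhd v → a ≢ u → dist v a ≤ dist u a
  Nbhd⊆⇒dist-≤ {u} {v} {a} Nu⊆Nv a≢u
    with w , u~w , closer ← ∃-closer-neighbour (a≢u ∘ sym) = begin
    dist v a        ≤⟨ dist-≤-via-neighbour a (∈Nbhd⇒Adj (Nu⊆Nv (Adj⇒∈Nbhd u~w))) ⟩
    suc (dist w a)  ≤⟨ closer ⟩
    dist u a        ∎
    where open ≤-Reasoning

  Nbhd≡⇒dist≡ : ∀ {u v a} → Nbhd u ⊆ Nbhd v → Nbhd v ⊆ Nbhd u → a ≢ u → a ≢ v →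
                dist a u ≡ dist a v
  Nbhd≡⇒dist≡ {u} {v} {a} Nu⊆Nv Nv⊆Nu a≢u a≢v = begin
    dist a u  ≡⟨ dist-sym a u ⟩
    dist u a  ≡⟨ ≤-antisym (Nbhd⊆⇒dist-≤ Nv⊆Nu a≢v) (Nbhd⊆⇒dist-≤ Nu⊆Nv a≢u) ⟩
    dist v a  ≡⟨ dist-sym v a ⟩
    dist a v  ∎
    where open ≡-Reasoning

  Agree : Subset n → Fin n → Fin n → Set
  Agree W x y = ∀ w → w ∈ W → dist w x ≡ dist w y

  Agree-sym : ∀ {W x y} → Agree W x y → Agree W y x
  Agree-sym agree w w∈W = sym (agree w w∈W)

  Resolves : Subset n → Set
  Resolves W = ∀ x y → Agree W x y → x ≡ y

  Resolves⇒Resolving : ∀ {W} → Resolves W → Resolving G W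
  Resolves⇒Resolving res x y same = res x y λ w w∈W → begin
    dist w x  ≡⟨ dist-sym w x ⟩
    dist x w  ≡⟨ Dist⇒≡dist (same w w∈W _ (Dist-dist x w)) ⟩
    dist y w  ≡⟨ dist-sym y w ⟩
    dist w y  ∎
    where open ≡-Reasoning

  Resolving⇒Resolves : ∀ {W} → Resolving G W → Resolves W
  Resolving⇒Resolves res x y agree = res x y λ w w∈W m D → subst (Dist G y w) (begin
    dist y w  ≡⟨ dist-sym y w ⟩
    dist w y  ≡⟨ agree w w∈W ⟨
    dist w x  ≡⟨ dist-sym w x ⟩
    dist x w  ≡⟨ Dist⇒≡dist D ⟨
    m         ∎) (Dist-dist y w)
    where open ≡-Reasoning

  ∈∧Agree⇒≡ : ∀ {W x y} → x ∈ W → Agree W x y → x ≡ y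
  ∈∧Agree⇒≡ {x = x} x∈W agree = dist≡0⇒≡ (trans (sym (agree x x∈W)) (dist-refl x))

  ⊤-x-resolves : ∀ x → Resolves (⊤ - x)
  ⊤-x-resolves x p q agree with p ≟ x | q ≟ x
  ... | yes refl | yes refl = refl
  ... | no p≢x   | _        = ∈∧Agree⇒≡ (x∈p∧x≢y⇒x∈p-y ∈⊤ p≢x) agree
  ... | yes _    | no q≢x   = sym (∈∧Agree⇒≡ (x∈p∧x≢y⇒x∈p-y ∈⊤ q≢x) (Agree-sym agree))

  ⊤-x-y-resolves : ∀ {x y c} → c ∈ ⊤ - x - y → dist c x ≢ dist c y → Resolves (⊤ - x - y)
  ⊤-x-y-resolves {x} {y} {c} c∈W separates p q agree with p ≟ q
  ... | yes p≡q = p≡q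
  ... | no p≢q  = pair (∉⇒x∨y (p≢q ∘ flip ∈∧Agree⇒≡ agree))
                       (∉⇒x∨y (p≢q ∘ sym ∘ flip ∈∧Agree⇒≡ (Agree-sym agree)))
    where
    ∉⇒x∨y : ∀ {z} → z ∉ ⊤ - x - y → z ≡ x ⊎ z ≡ y
    ∉⇒x∨y {z} z∉W with z ≟ x | z ≟ y
    ... | yes z≡x | _       = inj₁ z≡x
    ... | no _    | yes z≡y = inj₂ z≡y
    ... | no z≢x  | no z≢y  = contradiction (x∈p∧x≢y⇒x∈p-y (x∈p∧x≢y⇒x∈p-y ∈⊤ z≢x) z≢y) z∉W
    pair : p ≡ x ⊎ p ≡ y → q ≡ x ⊎ q ≡ y → p ≡ q
    pair (inj₁ refl) (inj₁ refl) = refl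
    pair (inj₂ refl) (inj₂ refl) = refl
    pair (inj₁ refl) (inj₂ refl) = contradiction (agree c c∈W) separates
    pair (inj₂ refl) (inj₁ refl) = contradiction (sym (agree c c∈W)) separates

module RandomlyDimensional {n} (G : Graph n) (connected : Connected G) {k : ℕ}
                           (randomly : RandomlyDim G (suc k)) where
  open Neighbourhoods G
  open Distances G connected

  resolves⇒1+k≤∣W∣ : ∀ {W} → Resolves W → suc k ≤ ∣ W ∣
  resolves⇒1+k≤∣W∣ res = proj₂ (proj₁ randomly) _ (Resolves⇒Resolving res)

  ¬resolves-size-k : ∀ {W} → Resolves W → ∣ W ∣ ≢ k
  ¬resolves-size-k res ∣W∣≡k = 1+n≰n (subst (suc k ≤_) ∣W∣≡k (resolves⇒1+k≤∣W∣ res))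

  Agree⇒separated-outside : ∀ {W x y s} → ∣ W ∣ ≡ k → Agree W x y → x ≢ y → s ∉ W →
                            dist s x ≢ dist s y
  Agree⇒separated-outside {W} {x} {y} {s} ∣W∣≡k agree x≢y s∉W same = x≢y
    (Resolving⇒Resolves (proj₂ randomly (W ∪ ⁅ s ⁆) ∣W+s∣≡1+k) x y agree′)
    where
    ∣W+s∣≡1+k : ∣ W ∪ ⁅ s ⁆ ∣ ≡ suc k
    ∣W+s∣≡1+k = trans (x∉p⇒∣p∪⁅x⁆∣≡1+∣p∣ s∉W) (cong suc ∣W∣≡k)
    agree′ : Agree (W ∪ ⁅ s ⁆) x y
    agree′ w w∈W+s with x∈p∪q⁻ W ⁅ s ⁆ w∈W+s
    ... | inj₁ w∈W   = agree w w∈W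
    ... | inj₂ w∈⁅s⁆ = subst (λ t → dist t x ≡ dist t y) (sym (x∈⁅y⁆⇒x≡y s w∈⁅s⁆)) same

  Agree⇒outsider-in-pair : ∀ {W x y s} → ∣ W ∣ ≡ k → Agree W x y → x ≢ y → s ∉ W →
                           Nbhd s ⊆ W → s ≡ x ⊎ s ≡ y
  Agree⇒outsider-in-pair {x = x} {y} {s} ∣W∣≡k agree x≢y s∉W Ns⊆W with s ≟ x | s ≟ y
  ... | yes s≡x | _       = inj₁ s≡x
  ... | no _    | yes s≡y = inj₂ s≡y
  ... | no s≢x  | no s≢y  = contradiction
    (neighbours-agree⇒dist≡ s≢x s≢y (λ w s~w → agree w (Ns⊆W (Adj⇒∈Nbhd s~w))))
    (Agree⇒separated-outside ∣W∣≡k agree x≢y s∉W)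

  Agree⇒Nbhd⊆ : ∀ {W u v} → Agree W u v → Nbhd u ⊆ W → Nbhd u ⊆ Nbhd v
  Agree⇒Nbhd⊆ {u = u} {v} agree Nu⊆W {w} w∈Nu = Adj⇒∈Nbhd (dist≡1⇒Adj (begin
    dist v w  ≡⟨ dist-sym v w ⟩
    dist w v  ≡⟨ agree w (Nu⊆W w∈Nu) ⟨
    dist w u  ≡⟨ dist-sym w u ⟩
    dist u w  ≡⟨ Adj⇒dist≡1 (∈Nbhd⇒Adj w∈Nu) ⟩
    1         ∎))
    where open ≡-Reasoning

  Agree⇒dist≡ : ∀ {W u v a} → Agree W u v → Nbhd u ⊆ W → Nbhd v ⊆ W → a ≢ u → a ≢ v →
                dist a u ≡ dist a v
  Agree⇒dist≡ agree Nu⊆W Nv⊆W =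
    Nbhd≡⇒dist≡ (Agree⇒Nbhd⊆ agree Nu⊆W) (Agree⇒Nbhd⊆ (Agree-sym agree) Nv⊆W)

  resolves-with-spare-outsider : ∀ {W u v a} → ∣ W ∣ ≡ k → u ≢ v →
    u ∉ W → v ∉ W → Nbhd u ⊆ W → Nbhd v ⊆ W → a ∉ W → a ≢ u → a ≢ v → Resolves W
  resolves-with-spare-outsider ∣W∣≡k u≢v u∉W v∉W Nu⊆W Nv⊆W a∉W a≢u a≢v x y agree
    with x ≟ y
  ... | yes x≡y = x≡y
  ... | no x≢y with Agree⇒outsider-in-pair ∣W∣≡k agree x≢y u∉W Nu⊆W
                  | Agree⇒outsider-in-pair ∣W∣≡k agree x≢y v∉W Nv⊆W
  ... | inj₁ refl | inj₁ refl = contradiction refl u≢v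
  ... | inj₂ refl | inj₂ refl = contradiction refl u≢v
  ... | inj₁ refl | inj₂ refl = contradiction (Agree⇒dist≡ agree Nu⊆W Nv⊆W a≢u a≢v)
                                              (Agree⇒separated-outside ∣W∣≡k agree x≢y a∉W)
  ... | inj₂ refl | inj₁ refl = contradiction (Agree⇒dist≡ agree Nv⊆W Nu⊆W a≢v a≢u)
                                              (Agree⇒separated-outside ∣W∣≡k agree x≢y a∉W)

module NonAdjacentPair {n} {G : Graph n} (connected : Connected G) {k : ℕ}
                       (randomly : RandomlyDim G (suc k))
                       {u v : Fin n} (u≢v : u ≢ v) (u≁v : ¬ Adj G u v) where
  open Neighbourhoods G
  open Distances G connected
  open RandomlyDimensional G connected randomly

  u∈⊤-v : u ∈ ⊤ - v
  u∈⊤-v = x∈p∧x≢y⇒x∈p-y ∈⊤ u≢v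

  ≢v,u⇒∈⊤-v-u : ∀ {w} → w ≢ v → w ≢ u → w ∈ ⊤ - v - u
  ≢v,u⇒∈⊤-v-u w≢v w≢u = x∈p∧x≢y⇒x∈p-y (x∈p∧x≢y⇒x∈p-y ∈⊤ w≢v) w≢u

  ∈⊤-v-u⇒≢u : ∀ {w} → w ∈ ⊤ - v - u → w ≢ u
  ∈⊤-v-u⇒≢u = x∈p-y⇒x≢y

  ∈⊤-v-u⇒≢v : ∀ {w} → w ∈ ⊤ - v - u → w ≢ v
  ∈⊤-v-u⇒≢v w∈⊤-v-u = x∈p-y⇒x≢y (p─q⊆p (⊤ - v) ⁅ u ⁆ w∈⊤-v-u)

  Nbhd-u∪v⊆⊤-v-u : Nbhd u ∪ Nbhd v ⊆ ⊤ - v - u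
  Nbhd-u∪v⊆⊤-v-u w∈Nu∪Nv with x∈p∪q⁻ (Nbhd u) (Nbhd v) w∈Nu∪Nv
  ... | inj₁ w∈Nu = ≢v,u⇒∈⊤-v-u (λ { refl → u≁v u~w }) (Adj⇒≢ u~w ∘ sym)
    where u~w = ∈Nbhd⇒Adj w∈Nu
  ... | inj₂ w∈Nv = ≢v,u⇒∈⊤-v-u (Adj⇒≢ v~w ∘ sym) (λ { refl → u≁v (Adj-sym v~w) })
    where v~w = ∈Nbhd⇒Adj w∈Nv

  ∣Nbhd-u∪v∣≤k : deg G u + deg G v ≤ k → ∣ Nbhd u ∪ Nbhd v ∣ ≤ k
  ∣Nbhd-u∪v∣≤k deg-sum≤k = ≤-trans (∣p∪q∣≤∣p∣+∣q∣ (Nbhd u) (Nbhd v))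
    (subst₂ (λ du dv → du + dv ≤ k) (deg≡∣Nbhd∣ u) (deg≡∣Nbhd∣ v) deg-sum≤k)

  k≤∣⊤-v-u∣ : k ≤ ∣ ⊤ - v - u ∣
  k≤∣⊤-v-u∣ = ≤-pred (subst (suc k ≤_) (x∈p⇒∣p∣≡1+∣p-x∣ u∈⊤-v)
                               (resolves⇒1+k≤∣W∣ (⊤-x-resolves v)))

  ∣⊤-v-u∣≢k : ∣ ⊤ - v - u ∣ ≢ k
  ∣⊤-v-u∣≢k ∣⊤-v-u∣≡k with z , u~z , _ ← ∃-closer-neighbour u≢v =
    ¬resolves-size-k (⊤-x-y-resolves u∈⊤-v-z u-separates-v-z)
                     (trans (x,y∈p⇒∣p-x∣≡∣p-y∣ z∈⊤-v u∈⊤-v) ∣⊤-v-u∣≡k)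
    where
    z∈⊤-v : z ∈ ⊤ - v
    z∈⊤-v = x∈p∧x≢y⇒x∈p-y ∈⊤ λ { refl → u≁v u~z }
    u∈⊤-v-z : u ∈ ⊤ - v - z
    u∈⊤-v-z = x∈p∧x≢y⇒x∈p-y u∈⊤-v (Adj⇒≢ u~z)
    u-separates-v-z : dist u v ≢ dist u z
    u-separates-v-z d≡ = u≁v (dist≡1⇒Adj (trans d≡ (Adj⇒dist≡1 u~z)))

  k≮∣⊤-v-u∣ : deg G u + deg G v ≤ k → ¬ k < ∣ ⊤ - v - u ∣
  k≮∣⊤-v-u∣ deg-sum≤k k<∣⊤-v-u∣
    with W , N⊆W , W⊆⊤-v-u , ∣W∣≡k
           ← ⊆-interpolate k Nbhd-u∪v⊆⊤-v-u (∣Nbhd-u∪v∣≤k deg-sum≤k) (<⇒≤ k<∣⊤-v-u∣)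
    with a , a∈⊤-v-u , a∉W ← ∣p∣<∣q∣⇒∃[x∈q∖p] (subst (_< ∣ ⊤ - v - u ∣) (sym ∣W∣≡k) k<∣⊤-v-u∣)
    = ¬resolves-size-k
        (resolves-with-spare-outsider ∣W∣≡k u≢v
           (λ u∈W → ∈⊤-v-u⇒≢u (W⊆⊤-v-u u∈W) refl) (λ v∈W → ∈⊤-v-u⇒≢v (W⊆⊤-v-u v∈W) refl)
           (λ w∈Nu → N⊆W (p⊆p∪q (Nbhd v) w∈Nu)) (λ w∈Nv → N⊆W (q⊆p∪q (Nbhd u) (Nbhd v) w∈Nv))
           a∉W (∈⊤-v-u⇒≢u a∈⊤-v-u) (∈⊤-v-u⇒≢v a∈⊤-v-u))
        ∣W∣≡k

  deg-sum≰k : ¬ (deg G u + deg G v ≤ k)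
  deg-sum≰k deg-sum≤k = [ k≮∣⊤-v-u∣ deg-sum≤k , ∣⊤-v-u∣≢k ∘ sym ] (m≤n⇒m<n∨m≡n k≤∣⊤-v-u∣)

mainTheorem8 : ∀ {n : ℕ} (G : Graph n) (k : ℕ) →
    Connected G → RandomlyDim G k →
    (u v : Fin n) → ¬ u ≡ v → ¬ Adj G u v →
    deg G u + deg G v ≥ k
mainTheorem8 G zero    _         _        _ _ _   _   = z≤n
mainTheorem8 G (suc k) connected randomly u v u≢v u≁v = ≮⇒≥ (deg-sum≰k ∘ ≤-pred)
  where open NonAdjacentPair connected randomly u≢v u≁v
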